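{- Let $M=M_{n,k}$ be the cyclic $(n,k)$-matrix. Then every pair of columns of $M$ represents the same cyclic sequence: for any columns $C_j,C_{j'}$ there is an integer $s$ such that $m_{i,j'}=m_{i+s,j}$ for all $0\le i\le n-1$ (row index taken mod $n$).
   Context: The cyclic $(n,k)$-matrix ($n\ge1$, $0\le k\le n$) is $M_{n,k}=(m_{i,j})_{0\le i,j\le n-1}$ with $m_{i,j}=1$ iff $j\equiv ik+a\pmod n$ for some $0\le a\le k-1$, and $m_{i,j}=0$ otherwise. -}

module Defs where

open import Data.Nat using (ℕ; suc; _+_; _*_; NonZero)
open import Data.Nat.DivMod using (_%_)
open import Data.Fin using (Fin; toℕ; fromℕ<)
open import Data.Nat.DivMod using (m%n<n)
open import Data.Bool using (Bool)
open import Data.List using (upTo)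
open import Data.Bool.ListAction using (any)
open import Relation.Nullary.Decidable using (⌊_⌋)
import Data.Nat as ℕ
import Data.Integer as ℤ
open import Data.Integer using (ℤ)
open import Data.Integer.DivMod using (n%ℕd<d)

-- Entry m_{i,j} of the cyclic (n,k)-matrix M_{n,k} (indices 0..n-1), as a 0/1 value:
-- true iff  j ≡ i*k + a (mod n)  for some 0 ≤ a ≤ k-1.
-- Since j ∈ {0..n-1}, "j ≡ x (mod n)" is  toℕ j ≡ x % n.
cyclicEntry : (n k : ℕ) .{{_ : NonZero n}} → Fin n → Fin n → Bool
cyclicEntry n k i j = any (λ a → ⌊ toℕ j ℕ.≟ ((toℕ i * k + a) % n) ⌋) (upTo k)

shiftRow : (n : ℕ) .{{_ : NonZero n}} → Fin n → ℤ → Fin n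
shiftRow n i s = fromℕ< (n%ℕd<d (ℤ.+ toℕ i ℤ.+ s) n)

{-# OPTIONS --safe #-}
-- Row i of column j is set iff (j − i k) mod (n + 1) < k. With g = gcd k (n + 1), k = k′ g,
-- n + 1 = N′ g and j = r + g b (r < g) this becomes (b − i k′) mod N′ < k′, independent of r.
-- Shifting the row index by s replaces b by b − s k′, and since k′ is invertible modulo N′
-- a suitable s turns column j into column j′.
module Submission where

open import Data.Bool using (T)
open import Data.Bool.ListAction using (any)
open import Data.Fin using (Fin; toℕ)
open import Data.Fin.Properties using (toℕ-fromℕ<; toℕ<n)
open import Data.Integer using (ℤ)
import Data.Integer as ℤ
open import Data.List using (upTo)
open import Data.List.Membership.Propositional using (find; lose)
open import Data.List.Membership.Propositional.Properties using (∈-upTo⁺; ∈-upTo⁻)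
open import Data.List.Relation.Unary.Any.Properties using (any⁺; any⁻)
open import Data.Nat using (ℕ; suc; _+_; _*_; _≤_; _<_; _<?_; _≟_; NonZero; ≢-nonZero)
open import Data.Nat.Coprimality using (Coprime; coprime-Bézout; coprime-/gcd)
open import Data.Nat.Divisibility using (_∣_; divides; ∣n⇒∣m*n)
open import Data.Nat.DivMod hiding (_mod_)
open import Data.Nat.GCD using (gcd; gcd[m,n]∣m; gcd[m,n]∣n; gcd[m,n]≢0; n/gcd[m,n]≢0; module Bézout)
open import Data.Nat.Properties
open import Data.Nat.Tactic.RingSolver using (solve-∀)
open import Data.Product using (∃; ∃-syntax; _×_; _,_; proj₁; proj₂)
open import Data.Sum using (inj₂)
open import Function using (_⇔_; mk⇔)
import Function.Properties.Equivalence as ⇔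
open import Relation.Binary.PropositionalEquality
  using (_≡_; refl; sym; trans; cong; cong₂; subst; subst₂; module ≡-Reasoning)
open import Relation.Nullary.Decidable using (⌊_⌋; toWitness; fromWitness; does-⇔; isYes≗does; T?)
open import Relation.Unary using (Pred; Decidable)

open import Defs

infix 4 _≡_mod_

_≡_mod_ : ℕ → ℕ → (d : ℕ) → .{{NonZero d}} → Set
x ≡ y mod d = x % d ≡ y % d

module _ {d : ℕ} .{{_ : NonZero d}} where
  open ≡-Reasoning

  m%d≡m-mod : ∀ x → x % d ≡ x mod d
  m%d≡m-mod x = m%n%n≡m%n x d

  +-cong-mod : ∀ {x x′ y y′} → x ≡ x′ mod d → y ≡ y′ mod d → x + y ≡ x′ + y′ mod d
  +-cong-mod {x} {x′} {y} {y′} x≡x′ y≡y′ = begin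
    (x + y) % d           ≡⟨ %-distribˡ-+ x y d ⟩
    (x % d + y % d) % d   ≡⟨ cong₂ (λ u v → (u + v) % d) x≡x′ y≡y′ ⟩
    (x′ % d + y′ % d) % d ≡⟨ %-distribˡ-+ x′ y′ d ⟨
    (x′ + y′) % d         ∎

  *-cong-mod : ∀ {x x′ y y′} → x ≡ x′ mod d → y ≡ y′ mod d → x * y ≡ x′ * y′ mod d
  *-cong-mod {x} {x′} {y} {y′} x≡x′ y≡y′ = begin
    (x * y) % d           ≡⟨ %-distribˡ-* x y d ⟩
    (x % d * (y % d)) % d ≡⟨ cong₂ (λ u v → (u * v) % d) x≡x′ y≡y′ ⟩
    (x′ % d * (y′ % d)) % d ≡⟨ %-distribˡ-* x′ y′ d ⟨
    (x′ * y′) % d         ∎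

  [m+n%d]%d≡[m+n]%d : ∀ m n → m + n % d ≡ m + n mod d
  [m+n%d]%d≡[m+n]%d m n = +-cong-mod refl (m%d≡m-mod n)

  [m%d+n]%d≡[m+n]%d : ∀ m n → m % d + n ≡ m + n mod d
  [m%d+n]%d≡[m+n]%d m n = +-cong-mod (m%d≡m-mod m) refl

  ≡1⇒*-identityˡ-mod : ∀ {x} y → x ≡ 1 mod d → x * y ≡ y mod d
  ≡1⇒*-identityˡ-mod y x≡1 = trans (*-cong-mod {y = y} x≡1 refl) (cong (_% d) (*-identityˡ y))

  ≡-mod-∣ : ∀ {m x y} .{{_ : NonZero m}} → d ∣ m → x ≡ y mod m → x ≡ y mod d
  ≡-mod-∣ {m} {x} {y} d∣m x≡y = begin
    x % d     ≡⟨ m∣n⇒o%n%m≡o%m d m x d∣m ⟨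
    x % m % d ≡⟨ cong (_% d) x≡y ⟩
    y % m % d ≡⟨ m∣n⇒o%n%m≡o%m d m y d∣m ⟩
    y % d     ∎

coprime⇒∃inverse : ∀ {m d} .{{_ : NonZero d}} → Coprime m d → ∃[ u ] u * m ≡ 1 mod d
coprime⇒∃inverse {m} {d@(suc d-1)} c with coprime-Bézout c
... | Bézout.+- x y eq = x , (begin
  x * m % d       ≡⟨ cong (_% d) eq ⟨
  (1 + y * d) % d ≡⟨ [m+kn]%n≡m%n 1 y d ⟩
  1 % d           ∎)
  where open ≡-Reasoning
-- Here x is an inverse of −m, and d − 1 ≡ −1.
... | Bézout.-+ x y eq = d-1 * x , (begin
  d-1 * x * m % d           ≡⟨ [m+kn]%n≡m%n (d-1 * x * m) 1 d ⟨
  (d-1 * x * m + 1 * d) % d ≡⟨ cong (_% d) rearrange ⟩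
  (1 + d-1 * y * d) % d     ≡⟨ [m+kn]%n≡m%n 1 (d-1 * y) d ⟩
  1 % d                     ∎)
  where
  open ≡-Reasoning
  rearrange : d-1 * x * m + 1 * d ≡ 1 + d-1 * y * d
  rearrange = begin
    d-1 * x * m + 1 * d   ≡⟨ lemma d-1 x m ⟩
    1 + d-1 * (1 + x * m) ≡⟨ cong (λ v → 1 + d-1 * v) eq ⟩
    1 + d-1 * (y * d)     ≡⟨ cong (1 +_) (*-assoc d-1 y d) ⟨
    1 + d-1 * y * d       ∎
    where
    lemma : ∀ a b c → a * b * c + 1 * suc a ≡ 1 + a * (1 + b * c)
    lemma = solve-∀

n*n≡1-mod-1+n : ∀ n → n * n ≡ 1 mod suc n
n*n≡1-mod-1+n n = begin
  n * n % suc n             ≡⟨ [m+kn]%n≡m%n (n * n) 1 (suc n) ⟨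
  (n * n + 1 * suc n) % suc n ≡⟨ cong (_% suc n) (lemma n) ⟩
  (1 + n * suc n) % suc n   ≡⟨ [m+kn]%n≡m%n 1 n (suc n) ⟩
  1 % suc n                 ∎
  where
  open ≡-Reasoning
  lemma : ∀ n → n * n + 1 * suc n ≡ 1 + n * suc n
  lemma = solve-∀

m+[o+n*m]≡o-mod-1+n : ∀ n m o → m + (o + n * m) ≡ o mod suc n
m+[o+n*m]≡o-mod-1+n n m o = trans (cong (_% suc n) (lemma n m o)) ([m+kn]%n≡m%n o m (suc n))
  where
  lemma : ∀ n m o → m + (o + n * m) ≡ o + m * suc n
  lemma = solve-∀

T-any-upTo⇔ : ∀ {ℓ} {P : Pred ℕ ℓ} (P? : Decidable P) k →
              T (any (λ a → ⌊ P? a ⌋) (upTo k)) ⇔ (∃[ a ] a < k × P a)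
T-any-upTo⇔ P? k = mk⇔ to from
  where
  to : T (any (λ a → ⌊ P? a ⌋) (upTo k)) → ∃[ a ] a < k × _
  to h with a , a∈upTo , Pa ← find (any⁻ _ (upTo k) h) = a , ∈-upTo⁻ a∈upTo , toWitness Pa
  from : (∃[ a ] a < k × _) → T (any (λ a → ⌊ P? a ⌋) (upTo k))
  from (a , a<k , Pa) = any⁺ _ (lose (∈-upTo⁺ a<k) (fromWitness Pa))

-- (j − x) mod (1 + n), since n ≡ −1.
offset : ℕ → ℕ → ℕ → ℕ
offset n x j = (j + n * x) % suc n

module _ {n x j : ℕ} where
  open ≡-Reasoning

  offset-correct : j < suc n → j ≡ (x + offset n x j) % suc n
  offset-correct j<1+n = sym (begin
    (x + (j + n * x) % suc n) % suc n ≡⟨ [m+n%d]%d≡[m+n]%d x (j + n * x) ⟩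
    (x + (j + n * x)) % suc n         ≡⟨ m+[o+n*m]≡o-mod-1+n n x j ⟩
    j % suc n                         ≡⟨ m<n⇒m%n≡m j<1+n ⟩
    j                                 ∎)

  offset-unique : ∀ {a} → a < suc n → j ≡ (x + a) % suc n → offset n x j ≡ a
  offset-unique {a} a<1+n j≡ = begin
    (j + n * x) % suc n               ≡⟨ cong (λ v → (v + n * x) % suc n) j≡ ⟩
    ((x + a) % suc n + n * x) % suc n ≡⟨ [m%d+n]%d≡[m+n]%d (x + a) (n * x) ⟩
    (x + a + n * x) % suc n           ≡⟨ cong (_% suc n) (+-assoc x a (n * x)) ⟩
    (x + (a + n * x)) % suc n         ≡⟨ m+[o+n*m]≡o-mod-1+n n x a ⟩
    a % suc n                         ≡⟨ m<n⇒m%n≡m a<1+n ⟩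
    a                                 ∎

  ∃-offset⇔offset< : ∀ {k} → j < suc n → k ≤ suc n →
                     (∃[ a ] a < k × j ≡ (x + a) % suc n) ⇔ offset n x j < k
  ∃-offset⇔offset< {k} j<1+n k≤1+n = mk⇔
    (λ (a , a<k , j≡) → subst (_< k) (sym (offset-unique (<-≤-trans a<k k≤1+n) j≡)) a<k)
    (λ offset<k → offset n x j , offset<k , offset-correct j<1+n)

T-cyclicEntry⇔ : ∀ n k (i j : Fin (suc n)) → k ≤ suc n →
                 T (cyclicEntry (suc n) k i j) ⇔ offset n (toℕ i * k) (toℕ j) < k
T-cyclicEntry⇔ n k i j k≤1+n = ⇔.trans
  (T-any-upTo⇔ (λ a → toℕ j ≟ (toℕ i * k + a) % suc n) k)
  (∃-offset⇔offset< (toℕ<n j) k≤1+n)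

m*n+o<q*n⇔m<q : ∀ {m n o q} → o < n → m * n + o < q * n ⇔ m < q
m*n+o<q*n⇔m<q {m} {n} {o} {q} o<n = mk⇔
  (λ lt → *-cancelʳ-< n m q (≤-<-trans (m≤m+n (m * n) o) lt))
  (λ m<q → begin-strict
    m * n + o ≡⟨ +-comm (m * n) o ⟩
    o + m * n <⟨ +-monoˡ-< (m * n) o<n ⟩
    suc m * n ≤⟨ *-monoˡ-≤ n m<q ⟩
    q * n     ∎)
  where open ≤-Reasoning

[m*n+o]%[p*n]<q*n⇔m%p<q : ∀ m {n o} p q .{{_ : NonZero p}} .{{_ : NonZero (p * n)}} → o < n →
                          (m * n + o) % (p * n) < q * n ⇔ m % p < q
[m*n+o]%[p*n]<q*n⇔m%p<q m {n} {o} p q o<n =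
  subst (λ v → v < q * n ⇔ m % p < q) scaled (m*n+o<q*n⇔m<q o<n)
  where
  scaled : m % p * n + o ≡ (m * n + o) % (p * n)
  scaled = trans (cong (_+ o) (m%n*o≡m*o%[n*o] m p n)) (sym ([m*n+o]%[p*n]≡[m*n]%[p*n]+o m p o<n))

toℕ-shiftRow : ∀ n (i : Fin (suc n)) s → toℕ (shiftRow (suc n) i (ℤ.+ s)) ≡ (toℕ i + s) % suc n
toℕ-shiftRow n i s = toℕ-fromℕ< _

module CyclicMatrix (n k : ℕ) {g k′ N′ : ℕ} .{{_ : NonZero g}} .{{_ : NonZero N′}}
                    (k′*g≡k : k′ * g ≡ k) (N′*g≡1+n : N′ * g ≡ suc n) (coprime : Coprime k′ N′) where

  instance
    N′*g≢0 : NonZero (N′ * g)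
    N′*g≢0 = m*n≢0 N′ g

  N′∣1+n : N′ ∣ suc n
  N′∣1+n = divides g (trans (sym N′*g≡1+n) (*-comm N′ g))

  -- (b − i k′) mod N′, as n ≡ −1 modulo N′.
  phase : ℕ → ℕ → ℕ
  phase b i = (b + n * i * k′) % N′

  offset-decomposition : ∀ i j → j + n * (i * k) ≡ (j / g + n * i * k′) * g + j % g
  offset-decomposition i j = begin
    j + n * (i * k)                        ≡⟨ cong₂ (λ u v → u + n * (i * v)) (m≡m%n+[m/n]*n j g) (sym k′*g≡k) ⟩
    j % g + j / g * g + n * (i * (k′ * g)) ≡⟨ lemma (j % g) (j / g) n i k′ g ⟩
    (j / g + n * i * k′) * g + j % g       ∎
    where
    open ≡-Reasoning
    lemma : ∀ r q n i k′ g → r + q * g + n * (i * (k′ * g)) ≡ (q + n * i * k′) * g + r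
    lemma = solve-∀

  T-cyclicEntry⇔phase : k ≤ suc n → ∀ i j →
                        T (cyclicEntry (suc n) k i j) ⇔ phase (toℕ j / g) (toℕ i) < k′
  T-cyclicEntry⇔phase k≤1+n i j = ⇔.trans (T-cyclicEntry⇔ n k i j k≤1+n)
    (subst₂ (λ u v → u < v ⇔ phase (toℕ j / g) (toℕ i) < k′) (sym offset≡) k′*g≡k
      ([m*n+o]%[p*n]<q*n⇔m%p<q (toℕ j / g + n * toℕ i * k′) N′ k′ (m%n<n (toℕ j) g)))
    where
    offset≡ : offset n (toℕ i * k) (toℕ j) ≡ ((toℕ j / g + n * toℕ i * k′) * g + toℕ j % g) % (N′ * g)
    offset≡ = trans (cong (_% suc n) (offset-decomposition (toℕ i) (toℕ j))) (%-congʳ (sym N′*g≡1+n))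

  cyclicEntry≡phase : k ≤ suc n → ∀ i j → cyclicEntry (suc n) k i j ≡ ⌊ phase (toℕ j / g) (toℕ i) <? k′ ⌋
  cyclicEntry≡phase k≤1+n i j =
    trans (does-⇔ (T-cyclicEntry⇔phase k≤1+n i j) (T? _) (_ <? k′)) (sym (isYes≗does _))

  n*k′-invertible : ∃[ c ] n * c * k′ ≡ 1 mod N′
  n*k′-invertible with u , u*k′≡1 ← coprime⇒∃inverse coprime = n * u , (begin
    n * (n * u) * k′ % N′ ≡⟨ cong (_% N′) (lemma n u k′) ⟩
    n * n * (u * k′) % N′ ≡⟨ *-cong-mod {x = n * n} {x′ = 1} n*n≡1 u*k′≡1 ⟩
    1 % N′                ∎)
    where
    open ≡-Reasoning
    lemma : ∀ n u k′ → n * (n * u) * k′ ≡ n * n * (u * k′)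
    lemma = solve-∀
    n*n≡1 : n * n ≡ 1 mod N′
    n*n≡1 = ≡-mod-∣ N′∣1+n (n*n≡1-mod-1+n n)

  linear-congruence-solvable : ∀ a b → ∃[ s ] a + n * s * k′ ≡ b mod N′
  linear-congruence-solvable a b with c , n*c*k′≡1 ← n*k′-invertible = c * t , (begin
    (a + n * (c * t) * k′) % N′ ≡⟨ cong (λ v → (a + v) % N′) (lemma₁ n c t k′) ⟩
    (a + n * c * k′ * t) % N′   ≡⟨ +-cong-mod refl (≡1⇒*-identityˡ-mod t n*c*k′≡1) ⟩
    (a + t) % N′                ≡⟨ cong (_% N′) (lemma₂ n a b) ⟩
    (b + a * suc n) % N′        ≡⟨ %-remove-+ʳ b (∣n⇒∣m*n a N′∣1+n) ⟩
    b % N′                      ∎)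
    where
    open ≡-Reasoning
    t = b + n * a
    lemma₁ : ∀ n c t k′ → n * (c * t) * k′ ≡ n * c * k′ * t
    lemma₁ = solve-∀
    lemma₂ : ∀ n a b → a + (b + n * a) ≡ b + a * suc n
    lemma₂ = solve-∀

  phase-% : ∀ b m → phase b (m % suc n) ≡ phase b m
  phase-% b m = +-cong-mod {x = b} refl (*-cong-mod {y = k′} (*-cong-mod {x = n} refl m%[1+n]≡m) refl)
    where
    m%[1+n]≡m : m % suc n ≡ m mod N′
    m%[1+n]≡m = ≡-mod-∣ N′∣1+n (m%d≡m-mod m)

  phase-shift : ∀ a b → ∃[ s ] ∀ i → phase a ((i + s) % suc n) ≡ phase b i
  phase-shift a b with s , a+n*s*k′≡b ← linear-congruence-solvable a b = s , λ i → begin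
    phase a ((i + s) % suc n)          ≡⟨ phase-% a (i + s) ⟩
    (a + n * (i + s) * k′) % N′        ≡⟨ cong (_% N′) (lemma a n i s k′) ⟩
    (a + n * s * k′ + n * i * k′) % N′ ≡⟨ +-cong-mod a+n*s*k′≡b refl ⟩
    phase b i                          ∎
    where
    open ≡-Reasoning
    lemma : ∀ a n i s k′ → a + n * (i + s) * k′ ≡ a + n * s * k′ + n * i * k′
    lemma = solve-∀

proposition4p9 : (n k : ℕ) → k ≤ suc n → (j j′ : Fin (suc n)) →
    ∃ λ (s : ℤ) → (i : Fin (suc n)) →
      cyclicEntry (suc n) k i j′ ≡ cyclicEntry (suc n) k (shiftRow (suc n) i s) j
proposition4p9 n k k≤1+n j j′ = ℤ.+ s , λ i → begin
  cyclicEntry (suc n) k i j′                           ≡⟨ cyclicEntry≡phase k≤1+n i j′ ⟩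
  ⌊ phase b (toℕ i) <? k′ ⌋                            ≡⟨ cong (λ v → ⌊ v <? k′ ⌋) (shift (toℕ i)) ⟨
  ⌊ phase a ((toℕ i + s) % suc n) <? k′ ⌋              ≡⟨ cong (λ v → ⌊ phase a v <? k′ ⌋) (toℕ-shiftRow n i s) ⟨
  ⌊ phase a (toℕ (shiftRow (suc n) i (ℤ.+ s))) <? k′ ⌋ ≡⟨ cyclicEntry≡phase k≤1+n _ j ⟨
  cyclicEntry (suc n) k (shiftRow (suc n) i (ℤ.+ s)) j ∎
  where
  g : ℕ
  g = gcd k (suc n)
  instance
    g≢0 : NonZero g
    g≢0 = ≢-nonZero (gcd[m,n]≢0 k (suc n) (inj₂ λ ()))
    [1+n]/g≢0 : NonZero (suc n / g)
    [1+n]/g≢0 = ≢-nonZero (n/gcd[m,n]≢0 k (suc n))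
  open CyclicMatrix n k (m/n*n≡m (gcd[m,n]∣m k (suc n))) (m/n*n≡m (gcd[m,n]∣n k (suc n)))
                        (coprime-/gcd k (suc n))
  open ≡-Reasoning
  k′ a b s : ℕ
  k′ = k / g
  a = toℕ j / g
  b = toℕ j′ / g
  s = proj₁ (phase-shift a b)
  shift : ∀ i → phase a ((i + s) % suc n) ≡ phase b i
  shift = proj₂ (phase-shift a b)
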